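{- Let $G$ be a strongly connected simple directed graph, let $f_0$ be an initial valuation, and let $f_0,f_1,f_2,\dots$ be updated according to the asynchronous maximum model. Let $h(f_t)=|C_t|$, where $C_t$ is the strong cycle set of $f_t$. Then (for every realization of the process) $h(f_t)$ is non-negative, non-decreasing in $t$, and bounded above by $n$.
   Context: Let $G=(V,E)$ be a finite simple directed graph with $n=|V|$ vertices and $[n]=\{1,\dots,n\}$. A valuation is a function $f:V\to[n]$. The asynchronous maximum model: given $f_t$, choose $v'\in V$ uniformly at random; set $f_{t+1}(v')=\max\{f_t(u): u\neq v',\ (v',u)\in E\}$ if $v'$ has an out-neighbour (unchanged otherwise), and $f_{t+1}(v)=f_t(v)$ for $v\neq v'$. Let $M_t=\max_v f_t(v)$. A strong cycle for $f_t$ is a sequence $v_1,\dots,v_k,v_1$ of distinct vertices with $(v_i,v_{i+1})\in E$ for $i<k$, $(v_k,v_1)\in E$, and $f_t(v_i)=M_t$ for all $i$. The strong cycle set $C_t$ is the set of all vertices $v$ such that either $v$ lies on a strong cycle, or there is a walk $v=v_1,\dots,v_k$ in $G$ with $f_t(v_i)=M_t$ for all $i$ and $v_k$ lying on a strong cycle. -}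

module Defs where

open import Data.Nat using (ℕ; zero; suc; _≤_; _⊔_)
open import Data.Bool using (Bool; true; false; if_then_else_; _∧_; not)
open import Data.Fin using (Fin; _≟_)
open import Data.Fin.Subset using (Subset; _∈_)
open import Data.List using (List; []; _∷_; map; foldr; allFin; filterᵇ)
open import Data.List.Relation.Unary.All using (All)
open import Data.List.Relation.Unary.Unique.Propositional using (Unique)
import Data.List.Membership.Propositional as LM
open import Data.Maybe using (Maybe; just; nothing; maybe)
open import Data.Product using (_×_; ∃; ∃-syntax)
open import Data.Sum using (_⊎_)
open import Relation.Nullary.Decidable using (⌊_⌋)
open import Relation.Binary.PropositionalEquality using (_≡_)
open import Relation.Binary.Construct.Closure.ReflexiveTransitive using (Star)

Graph : ℕ → Set
Graph n = Fin n → Fin n → Bool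

Edge : ∀ {n} → Graph n → Fin n → Fin n → Set
Edge E u v = E u v ≡ true

-- simple: no loops (there are no multi-edges in a Boolean adjacency relation)
Simple : ∀ {n} → Graph n → Set
Simple E = ∀ v → E v v ≡ false

StronglyConnected : ∀ {n} → Graph n → Set
StronglyConnected E = ∀ u v → Star (Edge E) u v

Valuation : ℕ → Set
Valuation n = Fin n → ℕ

ValidValuation : ∀ n → Valuation n → Set
ValidValuation n f = ∀ v → 1 ≤ f v × f v ≤ n

maxList : List ℕ → Maybe ℕ
maxList [] = nothing
maxList (x ∷ xs) = just (maybe (x ⊔_) x (maxList xs))

outNbrs : ∀ {n} → Graph n → Fin n → List (Fin n)
outNbrs {n} E v = filterᵇ (λ u → E v u ∧ not ⌊ u ≟ v ⌋) (allFin n)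

update : ∀ {n} → Graph n → Valuation n → Fin n → Valuation n
update E f v' v =
  if ⌊ v ≟ v' ⌋
  then maybe (λ m → m) (f v') (maxList (map f (outNbrs E v')))
  else f v

-- the process f₀, f₁, … for a realization s (s t = vertex chosen at step t)
run : ∀ {n} → Graph n → Valuation n → (ℕ → Fin n) → ℕ → Valuation n
run E f₀ s zero = f₀
run E f₀ s (suc t) = update E (run E f₀ s t) (s t)

maxVal : ∀ {n} → Valuation n → ℕ
maxVal {n} f = foldr _⊔_ 0 (map f (allFin n))

data Chain {n} (E : Graph n) : List (Fin n) → Set where
  nil  : Chain E []
  one  : ∀ v → Chain E (v ∷ [])
  cons : ∀ {u v vs} → Edge E u v → Chain E (v ∷ vs) → Chain E (u ∷ v ∷ vs)

lastOr : ∀ {n} → Fin n → List (Fin n) → Fin n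
lastOr v [] = v
lastOr v (w ∷ ws) = lastOr w ws

IsStrongCycle : ∀ {n} → Graph n → Valuation n → Fin n → List (Fin n) → Set
IsStrongCycle E f v₁ rest =
  Unique (v₁ ∷ rest) × Chain E (v₁ ∷ rest) × Edge E (lastOr v₁ rest) v₁
  × All (λ u → f u ≡ maxVal f) (v₁ ∷ rest)

OnStrongCycle : ∀ {n} → Graph n → Valuation n → Fin n → Set
OnStrongCycle E f v =
  ∃[ v₁ ] ∃[ rest ] (IsStrongCycle E f v₁ rest × LM._∈_ v (v₁ ∷ rest))

InStrongCycleSet : ∀ {n} → Graph n → Valuation n → Fin n → Set
InStrongCycleSet E f v =
  OnStrongCycle E f v
  ⊎ (∃[ ws ] (Chain E (v ∷ ws) × All (λ u → f u ≡ maxVal f) (v ∷ ws)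
              × OnStrongCycle E f (lastOr v ws)))

IsStrongCycleSet : ∀ {n} → Graph n → Valuation n → Subset n → Set
IsStrongCycleSet E f S = ∀ v → (v ∈ S → InStrongCycleSet E f v) × (InStrongCycleSet E f v → v ∈ S)

-- Every vertex of the strong cycle set C is maximal and has a maximal out-neighbour (the next
-- vertex of its walk or cycle).  Updating such a vertex recomputes the maximum over its
-- out-neighbours, which is again the global maximum M, so it keeps its value; updating any
-- other vertex cannot raise a value above M.  Hence M and all values on C survive every step,
-- the walks and cycles witnessing membership in C remain witnesses, and C only grows.  That C is an actual
-- subset of V rests on its membership being decidable: witnessing cycles and walks can be
-- taken duplicate-free, hence of length at most n, so a bounded search finds them.
module Submission where

open import Defs
open import Data.Nat using (ℕ; zero; suc; _≤_; _≤′_; z≤n; s≤s; ≤′-reflexive; ≤′-step)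
import Data.Nat.Properties as ℕₚ
open import Data.Fin using (Fin; zero; suc; _≟_)
import Data.Fin.Properties as Finₚ
open import Data.Fin.Subset as Subset using (Subset; ∣_∣)
open import Data.Fin.Subset.Properties using (p⊆q⇒∣p∣≤∣q∣; ∣p∣≤n)
open import Data.Bool using (T; T?; true; not; _∧_)
import Data.Bool.Properties as Boolₚ
open import Data.List using (List; []; _∷_; length; lookup; map; allFin)
open import Data.List.Properties using (foldr-preservesᵇ; foldr-forcesᵇ)
open import Data.List.Relation.Unary.All as All using (All; []; _∷_)
open import Data.List.Relation.Unary.All.Properties using (map⁺; ¬Any⇒All¬)
open import Data.List.Relation.Unary.Any using (here; there)
open import Data.List.Relation.Unary.AllPairs using ([]; _∷_)
open import Data.List.Relation.Unary.Unique.Propositional using (Unique)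
open import Data.List.Membership.Propositional using (_∈_)
open import Data.List.Membership.Propositional.Properties using (∈-map⁺; ∈-allFin; ∈-filter⁺; ∈-lookup)
import Data.List.Membership.DecPropositional as DecMembership
import Data.List.Relation.Unary.Unique.DecPropositional as DecUnique
open import Data.Maybe using (maybe)
open import Data.Product using (_×_; _,_; proj₁; proj₂; ∃; ∃-syntax)
open import Data.Sum using (_⊎_; inj₁; inj₂)
open import Data.Empty using (⊥-elim)
open import Data.Unit using (tt)
import Data.Vec as Vec
import Data.Vec.Properties as Vecₚ
open import Function.Definitions using (Injective)
open import Relation.Nullary using (Dec; yes; no; contradiction)
open import Relation.Nullary.Decidable using (map′; _×-dec_; _⊎-dec_; does; ⌊_⌋; dec-true)
open import Relation.Binary.PropositionalEquality

maxOr : ℕ → List ℕ → ℕ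
maxOr d xs = maybe (λ m → m) d (maxList xs)

∈⇒≤maxOr : ∀ {x} d xs → x ∈ xs → x ≤ maxOr d xs
∈⇒≤maxOr d (y ∷ []) (here refl) = ℕₚ.≤-refl
∈⇒≤maxOr d (y ∷ []) (there ())
∈⇒≤maxOr d (y ∷ z ∷ zs) (here refl) = ℕₚ.m≤m⊔n y _
∈⇒≤maxOr d (y ∷ z ∷ zs) (there x∈) = ℕₚ.≤-trans (∈⇒≤maxOr d (z ∷ zs) x∈) (ℕₚ.m≤n⊔m y _)

maxOr-lub : ∀ {d K} xs → d ≤ K → All (_≤ K) xs → maxOr d xs ≤ K
maxOr-lub [] d≤K [] = d≤K
maxOr-lub (y ∷ []) _ (y≤K ∷ []) = y≤K
maxOr-lub (y ∷ z ∷ zs) d≤K (y≤K ∷ zs≤K) = ℕₚ.⊔-lub y≤K (maxOr-lub (z ∷ zs) d≤K zs≤K)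

maxVal-upperBound : ∀ {n} (f : Valuation n) u → f u ≤ maxVal f
maxVal-upperBound {n} f u = All.lookup bounded (∈-map⁺ f (∈-allFin u))
  where
  bounded : All (_≤ maxVal f) (map f (allFin n))
  bounded = foldr-forcesᵇ {P = _≤ maxVal f}
    (λ x y le → ℕₚ.m⊔n≤o⇒m≤o x y le , ℕₚ.m⊔n≤o⇒n≤o x y le) 0 _ ℕₚ.≤-refl

maxVal-least : ∀ {n K} (f : Valuation n) → (∀ u → f u ≤ K) → maxVal f ≤ K
maxVal-least {n} {K} f f≤K =
  foldr-preservesᵇ {P = _≤ K} ℕₚ.⊔-lub z≤n (map⁺ {P = _≤ K} (All.universal f≤K (allFin n)))

lookup-injective : ∀ {A : Set} {xs : List A} → Unique xs → Injective _≡_ _≡_ (lookup xs)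
lookup-injective (_ ∷ _) {zero} {zero} _ = refl
lookup-injective (x∉ ∷ _) {zero} {suc j} eq = ⊥-elim (All.lookup x∉ (∈-lookup j) eq)
lookup-injective (x∉ ∷ _) {suc i} {zero} eq = ⊥-elim (All.lookup x∉ (∈-lookup i) (sym eq))
lookup-injective (_ ∷ u) {suc i} {suc j} eq = cong suc (lookup-injective u eq)

unique⇒length≤n : ∀ {n} {xs : List (Fin n)} → Unique xs → length xs ≤ n
unique⇒length≤n u = Finₚ.injective⇒≤ (lookup-injective u)

dropThrough : ∀ {A : Set} {x : A} xs → x ∈ xs → List A
dropThrough (y ∷ ys) (here _) = ys
dropThrough (y ∷ ys) (there x∈) = dropThrough ys x∈

dropThrough-preserves : ∀ {A : Set} {P : List A → Set} → (∀ {y ys} → P (y ∷ ys) → P ys) →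
  ∀ {x xs} (x∈ : x ∈ xs) → P xs → P (x ∷ dropThrough xs x∈)
dropThrough-preserves tail (here refl) p = p
dropThrough-preserves {P = P} tail {xs = y ∷ ys} (there x∈) p =
  dropThrough-preserves {P = P} tail x∈ (tail {y} {ys} p)

lastOr-dropThrough : ∀ {n} {x y : Fin n} ys (x∈ : x ∈ y ∷ ys) →
  lastOr x (dropThrough (y ∷ ys) x∈) ≡ lastOr y ys
lastOr-dropThrough ys (here refl) = refl
lastOr-dropThrough (z ∷ zs) (there x∈) = lastOr-dropThrough zs x∈

anyList≤? : ∀ {n} m {Q : List (Fin n) → Set} → (∀ xs → Dec (Q xs)) →
  Dec (∃[ xs ] (length xs ≤ m × Q xs))
anyList≤? zero Q? = map′ (λ q → [] , z≤n , q) (λ { ([] , _ , q) → q ; (_ ∷ _ , () , _) }) (Q? [])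
anyList≤? (suc m) {Q} Q? =
  map′ to from (Q? [] ⊎-dec Finₚ.any? (λ x → anyList≤? m (λ xs → Q? (x ∷ xs))))
  where
  to : Q [] ⊎ ∃[ x ] ∃[ xs ] (length xs ≤ m × Q (x ∷ xs)) → ∃[ xs ] (length xs ≤ suc m × Q xs)
  to (inj₁ q) = [] , z≤n , q
  to (inj₂ (x , xs , le , q)) = x ∷ xs , s≤s le , q
  from : ∃[ xs ] (length xs ≤ suc m × Q xs) → Q [] ⊎ ∃[ x ] ∃[ xs ] (length xs ≤ m × Q (x ∷ xs))
  from ([] , _ , q) = inj₁ q
  from (x ∷ xs , s≤s le , q) = inj₂ (x , xs , le , q)

module _ {n} (E : Graph n) where

  open DecMembership (_≟_ {n}) using (_∈?_)
  open DecUnique (_≟_ {n}) using (unique?)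

  chain-tail : ∀ {x xs} → Chain E (x ∷ xs) → Chain E xs
  chain-tail (one _) = nil
  chain-tail (cons _ c) = c

  loopErase : ∀ {A B : Fin n → Set} v ws → Chain E (v ∷ ws) → All A (v ∷ ws) → B (lastOr v ws) →
    ∃[ ws' ] (Unique (v ∷ ws') × Chain E (v ∷ ws') × All A (v ∷ ws') × B (lastOr v ws'))
  loopErase v [] c a b = [] , [] ∷ [] , c , a , b
  loopErase {A} {B} v (w ∷ ws) (cons e c) (av ∷ a) b with loopErase {A} {B} w ws c a b
  ... | ws₁ , u , c₁ , a₁ , b₁ with v ∈? (w ∷ ws₁)
  ...   | no v∉ = w ∷ ws₁ , ¬Any⇒All¬ _ v∉ ∷ u , cons e c₁ , av ∷ a₁ , b₁
  ...   | yes v∈ = dropThrough (w ∷ ws₁) v∈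
                 , dropThrough-preserves {P = Unique} (λ { (_ ∷ u') → u' }) v∈ u
                 , dropThrough-preserves {P = Chain E} chain-tail v∈ c₁
                 , dropThrough-preserves {P = All A} All.tail v∈ a₁
                 , subst B (sym (lastOr-dropThrough ws₁ v∈)) b₁

  edge? : ∀ u v → Dec (Edge E u v)
  edge? u v = E u v Boolₚ.≟ true

  chain? : ∀ xs → Dec (Chain E xs)
  chain? [] = yes nil
  chain? (v ∷ []) = yes (one v)
  chain? (u ∷ v ∷ vs) with edge? u v | chain? (v ∷ vs)
  ... | yes e | yes c = yes (cons e c)
  ... | no ¬e | _ = no λ { (cons e _) → ¬e e }
  ... | yes _ | no ¬c = no λ { (cons _ c) → ¬c c }

  MaxAt : Valuation n → Fin n → Set
  MaxAt f u = f u ≡ maxVal f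

  allMaxAt? : ∀ f xs → Dec (All (MaxAt f) xs)
  allMaxAt? f = All.all? (λ u → f u ℕₚ.≟ maxVal f)

  isStrongCycle? : ∀ f v₁ rest → Dec (IsStrongCycle E f v₁ rest)
  isStrongCycle? f v₁ rest = unique? (v₁ ∷ rest) ×-dec chain? (v₁ ∷ rest)
    ×-dec edge? (lastOr v₁ rest) v₁ ×-dec allMaxAt? f (v₁ ∷ rest)

  onStrongCycle? : ∀ f v → Dec (OnStrongCycle E f v)
  onStrongCycle? f v = map′ to from (Finₚ.any? λ v₁ →
      anyList≤? n λ rest → isStrongCycle? f v₁ rest ×-dec (v ∈? (v₁ ∷ rest)))
    where
    Witness : Fin n → List (Fin n) → Set
    Witness v₁ rest = IsStrongCycle E f v₁ rest × v ∈ v₁ ∷ rest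
    to : ∃[ v₁ ] ∃[ rest ] (length rest ≤ n × Witness v₁ rest) → OnStrongCycle E f v
    to (v₁ , rest , _ , c) = v₁ , rest , c
    from : OnStrongCycle E f v → ∃[ v₁ ] ∃[ rest ] (length rest ≤ n × Witness v₁ rest)
    from (v₁ , rest , c) = v₁ , rest , ℕₚ.<⇒≤ (unique⇒length≤n (proj₁ (proj₁ c))) , c

  inStrongCycleSet? : ∀ f v → Dec (InStrongCycleSet E f v)
  inStrongCycleSet? f v = onStrongCycle? f v ⊎-dec map′ to from (anyList≤? n λ ws →
      chain? (v ∷ ws) ×-dec allMaxAt? f (v ∷ ws) ×-dec onStrongCycle? f (lastOr v ws))
    where
    Walk : List (Fin n) → Set
    Walk ws = Chain E (v ∷ ws) × All (MaxAt f) (v ∷ ws) × OnStrongCycle E f (lastOr v ws)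
    to : ∃[ ws ] (length ws ≤ n × Walk ws) → ∃[ ws ] Walk ws
    to (ws , _ , w) = ws , w
    from : ∃[ ws ] Walk ws → ∃[ ws ] (length ws ≤ n × Walk ws)
    from (ws , c , a , o) with loopErase {MaxAt f} {OnStrongCycle E f} v ws c a o
    ... | ws' , u , w' = ws' , ℕₚ.<⇒≤ (unique⇒length≤n u) , w'

  Stable : Valuation n → Fin n → Set
  Stable f u = MaxAt f u × ∃[ w ] (Edge E u w × MaxAt f w)

  chain-stable : ∀ {f x xs} → Chain E (x ∷ xs) → All (MaxAt f) (x ∷ xs) →
    ∃[ w ] (Edge E (lastOr x xs) w × MaxAt f w) → All (Stable f) (x ∷ xs)
  chain-stable (one _) (fx ∷ []) next = (fx , next) ∷ []
  chain-stable (cons e c) (fx ∷ fxs) next = (fx , _ , e , All.head fxs) ∷ chain-stable c fxs next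

  strongCycle-stable : ∀ {f v₁ rest} → IsStrongCycle E f v₁ rest → All (Stable f) (v₁ ∷ rest)
  strongCycle-stable {v₁ = v₁} (_ , c , e , a) = chain-stable c a (v₁ , e , All.head a)

  onStrongCycle⇒stable : ∀ {f v} → OnStrongCycle E f v → Stable f v
  onStrongCycle⇒stable (_ , _ , cycle , v∈) = All.lookup (strongCycle-stable cycle) v∈

  edge⇒outNbr : Simple E → ∀ {u w} → Edge E u w → T (E u w ∧ not ⌊ w ≟ u ⌋)
  edge⇒outNbr simple {u} {w} e with w ≟ u
  ... | yes refl = contradiction (trans (sym e) (simple u)) λ ()
  ... | no _ rewrite e = tt

  maxOr-outNbrs-≤ : ∀ f u → maxOr (f u) (map f (outNbrs E u)) ≤ maxVal f
  maxOr-outNbrs-≤ f u = maxOr-lub (map f (outNbrs E u)) (maxVal-upperBound f u)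
    (map⁺ {P = _≤ maxVal f} (All.universal (maxVal-upperBound f) _))

  update-≤-maxVal : ∀ f v' u → update E f v' u ≤ maxVal f
  update-≤-maxVal f v' u with u ≟ v'
  ... | no _ = maxVal-upperBound f u
  ... | yes refl = maxOr-outNbrs-≤ f u

  module _ (simple : Simple E) where

    update-stable : ∀ {f u} v' → Stable f u → update E f v' u ≡ f u
    update-stable {f} {u} v' (fu , w , e , fw) with u ≟ v'
    ... | no _ = refl
    ... | yes refl = trans (ℕₚ.≤-antisym (maxOr-outNbrs-≤ f u) maxVal≤) (sym fu)
      where
      w∈ : w ∈ outNbrs E u
      w∈ = ∈-filter⁺ (λ x → T? (E u x ∧ not ⌊ x ≟ u ⌋)) (∈-allFin w) (edge⇒outNbr simple e)
      maxVal≤ : maxVal f ≤ maxOr (f u) (map f (outNbrs E u))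
      maxVal≤ = subst (_≤ maxOr (f u) (map f (outNbrs E u))) fw (∈⇒≤maxOr (f u) _ (∈-map⁺ f w∈))

    maxVal-update : ∀ {f u} v' → Stable f u → maxVal (update E f v') ≡ maxVal f
    maxVal-update {f} {u} v' s@(fu , _) = ℕₚ.≤-antisym
      (maxVal-least _ (update-≤-maxVal f v'))
      (subst (_≤ _) (trans (update-stable v' s) fu) (maxVal-upperBound (update E f v') u))

    stable⇒maxAt-update : ∀ {f u} v' → Stable f u → MaxAt (update E f v') u
    stable⇒maxAt-update v' s@(fu , _) = trans (update-stable v' s) (trans fu (sym (maxVal-update v' s)))

    onStrongCycle-update : ∀ {f v} v' → OnStrongCycle E f v → OnStrongCycle E (update E f v') v
    onStrongCycle-update v' (v₁ , rest , cycle@(u , c , e , _) , v∈) =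
      v₁ , rest , (u , c , e , All.map (stable⇒maxAt-update v') (strongCycle-stable cycle)) , v∈

    inStrongCycleSet-update : ∀ {f v} v' → InStrongCycleSet E f v → InStrongCycleSet E (update E f v') v
    inStrongCycleSet-update v' (inj₁ o) = inj₁ (onStrongCycle-update v' o)
    inStrongCycleSet-update {f} {v} v' (inj₂ (ws , c , a , o)) = inj₂ (ws , c , maxAt' , onStrongCycle-update v' o)
      where
      maxAt' : All (MaxAt (update E f v')) (v ∷ ws)
      maxAt' = All.map (stable⇒maxAt-update v') (chain-stable c a (proj₂ (onStrongCycle⇒stable o)))

    inStrongCycleSet-run : ∀ {f₀ s t t' v} → t ≤′ t' →
      InStrongCycleSet E (run E f₀ s t) v → InStrongCycleSet E (run E f₀ s t') v
    inStrongCycleSet-run (≤′-reflexive refl) = λ v∈C → v∈C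
    inStrongCycleSet-run {s = s} (≤′-step {t'} t≤t') =
      λ v∈C → inStrongCycleSet-update (s t') (inStrongCycleSet-run t≤t' v∈C)

characteristicSubset : ∀ {n} {P : Fin n → Set} → (∀ v → Dec (P v)) →
  ∃ λ S → ∀ v → (v Subset.∈ S → P v) × (P v → v Subset.∈ S)
characteristicSubset {n} {P} P? = S , λ v → sound v , complete v
  where
  S : Subset n
  S = Vec.tabulate (λ v → does (P? v))
  lookup-S : ∀ v → Vec.lookup S v ≡ does (P? v)
  lookup-S = Vecₚ.lookup∘tabulate _
  sound : ∀ v → v Subset.∈ S → P v
  sound v v∈S with P? v | trans (sym (lookup-S v)) (Vecₚ.[]=⇒lookup v∈S)
  ... | yes p | _ = p
  ... | no _ | ()
  complete : ∀ v → P v → v Subset.∈ S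
  complete v p = Vecₚ.lookup⇒[]= v S (trans (lookup-S v) (dec-true (P? v) p))

mainTheorem14 : (n : ℕ) (E : Graph n) → Simple E → StronglyConnected E →
    (f₀ : Valuation n) → ValidValuation n f₀ → (s : ℕ → Fin n) →
    (∀ t → ∃ λ S → IsStrongCycleSet E (run E f₀ s t) S)
    × (∀ t t' (S S' : Subset n) → t ≤ t' →
         IsStrongCycleSet E (run E f₀ s t) S → IsStrongCycleSet E (run E f₀ s t') S' →
         0 ≤ ∣ S ∣ × ∣ S ∣ ≤ ∣ S' ∣ × ∣ S' ∣ ≤ n)
mainTheorem14 n E simple _ f₀ _ s = strongCycleSet-exists , strongCycleSet-grows
  where
  strongCycleSet-exists : ∀ t → ∃ λ S → IsStrongCycleSet E (run E f₀ s t) S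
  strongCycleSet-exists t = characteristicSubset (inStrongCycleSet? E (run E f₀ s t))

  strongCycleSet-grows : ∀ t t' (S S' : Subset n) → t ≤ t' →
    IsStrongCycleSet E (run E f₀ s t) S → IsStrongCycleSet E (run E f₀ s t') S' →
    0 ≤ ∣ S ∣ × ∣ S ∣ ≤ ∣ S' ∣ × ∣ S' ∣ ≤ n
  strongCycleSet-grows t t' S S' t≤t' S-spec S'-spec = z≤n , p⊆q⇒∣p∣≤∣q∣ S⊆S' , ∣p∣≤n S'
    where
    S⊆S' : S Subset.⊆ S'
    S⊆S' {v} v∈S = proj₂ (S'-spec v)
      (inStrongCycleSet-run E simple (ℕₚ.≤⇒≤′ t≤t') (proj₁ (S-spec v) v∈S))
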